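{- (a) Every DynFO-program has an equivalent DynFO-program none of whose update formulas contains a negation. (b) Every DynProp-program has an equivalent DynPropUCQ-program.
   Context: Dynamic complexity setting. A dynamic schema is a pair $(\tau_{in},\tau_{aux})$ of disjoint finite relational schemas; $\tau=\tau_{in}\cup\tau_{aux}$. A modification is $\mathrm{ins}_S(\vec a)$ or $\mathrm{del}_S(\vec a)$ for $S\in\tau_{in}$ and a tuple $\vec a$ of the arity of $S$. An update program assigns to every $R\in\tau_{aux}$ and every $\delta\in\{\mathrm{ins}_S,\mathrm{del}_S : S\in\tau_{in}\}$ a first-order formula $\phi^R_\delta(\vec u;\vec x)$ over $\tau$ (with equality), $|\vec u|$ = arity of $S$, $|\vec x|$ = arity of $R$. A state is $(D,\mathcal I,\mathcal A)$ with finite domain $D$, a $\tau_{in}$-database $\mathcal I$ and a $\tau_{aux}$-database $\mathcal A$ over $D$. Applying $\delta(\vec a)$ to a state $\mathcal S$ gives $(D,\delta(\mathcal I),\mathcal A')$ where $R^{\mathcal A'}=\{\vec b:\mathcal S\models\phi^R_\delta(\vec a;\vec b)\}$. A dynamic program is $(P,\mathrm{Init},Q)$ with $P$ an update program, $\mathrm{Init}$ an arbitrary mapping from $\tau_{in}$-databases to $\tau_{aux}$-databases over the same domain, and $Q\in\tau_{aux}$. It maintains a query $\mathcal Q$ if for every $\tau_{in}$-database $\mathcal D$ with domain $D$ and every finite modification sequence $\alpha$, $\mathcal Q(\alpha(\mathcal D))$ equals the interpretation of $Q$ in the state obtained from $(D,\mathcal D,\mathrm{Init}(\mathcal D))$ by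 applying $\alpha$. Two dynamic programs are equivalent if they maintain the same query. A $\mathrm{Dyn}\mathcal C$-program is a dynamic program all of whose update formulas lie in $\mathcal C$. FO = all first-order formulas; Prop = quantifier-free first-order formulas; PropUCQ = finite disjunctions of conjunctions of atoms. -}

module Defs where

open import Data.Nat using (ℕ; suc)
open import Data.Fin as Fin using (Fin)
open import Data.Vec using (Vec; _∷_; _++_)
open import Data.Vec.Properties using (≡-dec)
open import Data.List as List using (List; []; _∷_; allFin)
open import Data.Bool.ListAction using (any; all)
open import Data.Bool using (Bool; true; false; _∧_; _∨_; not)
open import Data.Sum using (_⊎_; inj₁; inj₂)
open import Data.Product using (Σ; _×_; _,_; proj₁; proj₂)
open import Relation.Nullary using (yes; no)
open import Relation.Binary.PropositionalEquality using (_≡_; refl; subst)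

-- A finite relational schema: the list of arities of its symbols.
Schema : Set
Schema = List ℕ

Sym : Schema → Set
Sym σ = Fin (List.length σ)

arity : (σ : Schema) → Sym σ → ℕ
arity σ s = List.lookup σ s

Tuple : ℕ → ℕ → Set
Tuple n k = Vec (Fin n) k

Rel : ℕ → ℕ → Set
Rel n k = Tuple n k → Bool

DB : Schema → ℕ → Set
DB σ n = (s : Sym σ) → Rel n (arity σ s)

record Sig : Set₁ where
  field
    Symb : Set
    ar   : Symb → ℕ
open Sig public

_⊕_ : Schema → Schema → Sig
τin ⊕ τaux = record { Symb = Sym τin ⊎ Sym τaux ; ar = λ { (inj₁ s) → arity τin s ; (inj₂ r) → arity τaux r } }

-- Formulas with free variables among Fin m (de Bruijn style: ∃/∀ bind variable zero).
data Formula (Σs : Sig) (m : ℕ) : Set where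
  ⊤ᶠ ⊥ᶠ : Formula Σs m
  rel  : (s : Symb Σs) → Vec (Fin m) (ar Σs s) → Formula Σs m
  eq   : Fin m → Fin m → Formula Σs m
  ¬ᶠ_  : Formula Σs m → Formula Σs m
  _∧ᶠ_ _∨ᶠ_ : Formula Σs m → Formula Σs m → Formula Σs m
  ∃ᶠ ∀ᶠ : Formula Σs (suc m) → Formula Σs m

Structure : Sig → ℕ → Set
Structure Σs n = (s : Symb Σs) → Rel n (ar Σs s)

lookupEnv : ∀ {n m} → Vec (Fin n) m → Fin m → Fin n
lookupEnv = Data.Vec.lookup

eval : ∀ {Σs m n} → Formula Σs m → Structure Σs n → Vec (Fin n) m → Bool
eval ⊤ᶠ 𝒮 ρ = true
eval ⊥ᶠ 𝒮 ρ = false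
eval (rel s ts) 𝒮 ρ = 𝒮 s (Data.Vec.map (lookupEnv ρ) ts)
eval (eq i j) 𝒮 ρ with lookupEnv ρ i Fin.≟ lookupEnv ρ j
... | yes _ = true
... | no _  = false
eval (¬ᶠ φ) 𝒮 ρ = not (eval φ 𝒮 ρ)
eval (φ ∧ᶠ ψ) 𝒮 ρ = eval φ 𝒮 ρ ∧ eval ψ 𝒮 ρ
eval (φ ∨ᶠ ψ) 𝒮 ρ = eval φ 𝒮 ρ ∨ eval ψ 𝒮 ρ
eval {n = n} (∃ᶠ φ) 𝒮 ρ = any (λ a → eval φ 𝒮 (a ∷ ρ)) (allFin n)
eval {n = n} (∀ᶠ φ) 𝒮 ρ = all (λ a → eval φ 𝒮 (a ∷ ρ)) (allFin n)

data NegFree {Σs m} : Formula Σs m → Set where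
  ⊤ᶠ : NegFree ⊤ᶠ
  ⊥ᶠ : NegFree ⊥ᶠ
  rel : ∀ s ts → NegFree (rel s ts)
  eq  : ∀ i j → NegFree (eq i j)
  _∧ᶠ_ : ∀ {φ ψ} → NegFree φ → NegFree ψ → NegFree (φ ∧ᶠ ψ)
  _∨ᶠ_ : ∀ {φ ψ} → NegFree φ → NegFree ψ → NegFree (φ ∨ᶠ ψ)
  ∃ᶠ : ∀ {φ} → NegFree {m = suc m} φ → NegFree (∃ᶠ φ)
  ∀ᶠ : ∀ {φ} → NegFree {m = suc m} φ → NegFree (∀ᶠ φ)

data QF {Σs m} : Formula Σs m → Set where
  ⊤ᶠ : QF ⊤ᶠ
  ⊥ᶠ : QF ⊥ᶠ
  rel : ∀ s ts → QF (rel s ts)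
  eq  : ∀ i j → QF (eq i j)
  ¬ᶠ_ : ∀ {φ} → QF φ → QF (¬ᶠ φ)
  _∧ᶠ_ : ∀ {φ ψ} → QF φ → QF ψ → QF (φ ∧ᶠ ψ)
  _∨ᶠ_ : ∀ {φ ψ} → QF φ → QF ψ → QF (φ ∨ᶠ ψ)

data IsAtom {Σs m} : Formula Σs m → Set where
  rel : ∀ s ts → IsAtom (rel s ts)
  eq  : ∀ i j → IsAtom (eq i j)

data IsConj {Σs m} : Formula Σs m → Set where
  atom : ∀ {φ} → IsAtom φ → IsConj φ
  ⊤ᶠ   : IsConj ⊤ᶠ
  _∧ᶠ_ : ∀ {φ ψ} → IsConj φ → IsConj ψ → IsConj (φ ∧ᶠ ψ)

data IsUCQ {Σs m} : Formula Σs m → Set where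
  conj : ∀ {φ} → IsConj φ → IsUCQ φ
  ⊥ᶠ   : IsUCQ ⊥ᶠ
  _∨ᶠ_ : ∀ {φ ψ} → IsUCQ φ → IsUCQ ψ → IsUCQ (φ ∨ᶠ ψ)

data ModKind : Set where
  ins del : ModKind

data Mod (σ : Schema) (n : ℕ) : Set where
  mod : ModKind → (S : Sym σ) → Tuple n (arity σ S) → Mod σ n

setTuple : ∀ σ {n} → DB σ n → (S : Sym σ) → Tuple n (arity σ S) → Bool → DB σ n
setTuple σ D S a b S' w with S' Fin.≟ S
... | no _ = D S' w
... | yes refl with ≡-dec Fin._≟_ w a
...   | yes _ = b
...   | no _  = D S' w

applyMod : ∀ {σ n} → Mod σ n → DB σ n → DB σ n
applyMod {σ} (mod ins S a) D = setTuple σ D S a true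
applyMod {σ} (mod del S a) D = setTuple σ D S a false

applyMods : ∀ {σ n} → List (Mod σ n) → DB σ n → DB σ n
applyMods [] D = D
applyMods (δ ∷ α) D = applyMods α (applyMod δ D)

-- φ^R_δ(u⃗; x⃗) : free variables u⃗ (first |S|) then x⃗ (next |R|)
UpdateProgram : Schema → Schema → Set
UpdateProgram τin τaux =
  (R : Sym τaux) → ModKind → (S : Sym τin) → Formula (τin ⊕ τaux) (arity τin S ℕ.+ arity τaux R)
  where import Data.Nat as ℕ

record State (τin τaux : Schema) (n : ℕ) : Set where
  constructor state
  field
    inp : DB τin n
    aux : DB τaux n
open State public

asStructure : ∀ {τin τaux n} → State τin τaux n → Structure (τin ⊕ τaux) n
asStructure 𝒮 (inj₁ s) = inp 𝒮 s
asStructure 𝒮 (inj₂ r) = aux 𝒮 r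

step : ∀ {τin τaux n} → UpdateProgram τin τaux → Mod τin n → State τin τaux n → State τin τaux n
step {τin} P (mod k S a) 𝒮 =
  state (applyMod {τin} (mod k S a) (inp 𝒮))
        (λ R b → eval (P R k S) (asStructure 𝒮) (a ++ b))

run : ∀ {τin τaux n} → UpdateProgram τin τaux → List (Mod τin n) → State τin τaux n → State τin τaux n
run P [] 𝒮 = 𝒮
run P (δ ∷ α) 𝒮 = run P α (step P δ 𝒮)

record DynProgram (τin τaux : Schema) : Set where
  field
    prog : UpdateProgram τin τaux
    init : ∀ {n} → DB τin n → DB τaux n   -- arbitrary initialisation mapping
    Q    : Sym τaux
open DynProgram public

qarity : ∀ {τin τaux} → DynProgram τin τaux → ℕ
qarity {τaux = τaux} P = arity τaux (Q P)

Query : Schema → ℕ → Set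
Query τin k = ∀ {n} → DB τin n → Rel n k

Maintains : ∀ {τin τaux} (P : DynProgram τin τaux) → Query τin (qarity P) → Set
Maintains {τin} P 𝒬 =
  ∀ n (D : DB τin n) (α : List (Mod τin n)) (b : Tuple n (qarity P)) →
    𝒬 (applyMods α D) b ≡ aux (run (prog P) α (state D (init P D))) (Q P) b

Equivalent : ∀ {τin τaux τaux'} → DynProgram τin τaux → DynProgram τin τaux' → Set
Equivalent {τin} P P' =
  Σ (qarity P ≡ qarity P') λ e →
  Σ (Query τin (qarity P)) λ 𝒬 → Maintains P 𝒬 × Maintains P' (subst (Query τin) e 𝒬)

AllUpdates : ∀ {τin τaux} → (∀ {m} → Formula (τin ⊕ τaux) m → Set) → DynProgram τin τaux → Set
AllUpdates C P = ∀ R k S → C (prog P R k S)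

-- Next to every auxiliary relation R keep a copy of R and of its complement,
-- and add the complements of the input relations and the inequality relation.
-- Pushing negations to the atoms, dualising ∧/∨ and ∃/∀ on the way, turns a
-- negated atom into a positive atom over one of these complements, so every
-- update formula φ of R has a negation-free equivalent, and ¬φ one that updates
-- the complement of R. The complement of an input relation is updated by
-- ¬S(x̄) ∧ x̄ ≠ ū (insertion) or ¬S(x̄) ∨ x̄ = ū (deletion), and the inequality
-- relation never changes. Quantifier-free formulas stay quantifier-free under
-- this translation, and distributing ∧ over ∨ then yields PropUCQ formulas.
module Submission where

open import Defs
open import Data.Product using (Σ; _×_; _,_; proj₁; proj₂)
open import Data.Nat using (ℕ; _+_)
open import Data.Fin as Fin using (Fin; zero; suc; _↑ˡ_; _↑ʳ_)
open import Data.Vec as V using (Vec; []; _∷_; _++_; tabulate; lookup)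
open import Data.Vec.Properties using (≡-dec; lookup-++ˡ; lookup-++ʳ; tabulate∘lookup; tabulate-cong; tabulate-∘)
open import Data.List as L using (List; []; _∷_)
open import Data.List.Properties using (map-cong)
open import Data.Bool using (Bool; true; false; _∧_; _∨_; not; if_then_else_)
open import Data.Bool.Properties
  using (not-involutive; ∧-identityʳ; ∨-identityʳ; ∧-zeroʳ; ∨-zeroʳ; ∧-distribˡ-∨; ∧-distribʳ-∨; ∨-assoc; ∧-assoc; ∨-∧-booleanAlgebra)
open import Algebra.Lattice.Properties.BooleanAlgebra ∨-∧-booleanAlgebra using (deMorgan₁; deMorgan₂)
open import Data.Bool.ListAction using (any; all; or; and)
open import Data.Sum using (inj₁; inj₂)
open import Function using (_∘_)
open import Relation.Nullary using (Dec; yes; no; does; ¬_; contradiction)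
open import Relation.Binary.PropositionalEquality
open import Relation.Binary.PropositionalEquality.Properties using (subst-subst-sym)

polar : Bool → Bool → Bool
polar true  x = x
polar false x = not x

any-cong : ∀ {X : Set} {f g : X → Bool} → (∀ x → f x ≡ g x) → ∀ xs → any f xs ≡ any g xs
any-cong f≗g xs = cong or (map-cong f≗g xs)

all-cong : ∀ {X : Set} {f g : X → Bool} → (∀ x → f x ≡ g x) → ∀ xs → all f xs ≡ all g xs
all-cong f≗g xs = cong and (map-cong f≗g xs)

all-not : ∀ {X : Set} (f : X → Bool) xs → all (not ∘ f) xs ≡ not (any f xs)
all-not f []       = refl
all-not f (x ∷ xs) = trans (cong (not (f x) ∧_) (all-not f xs)) (sym (deMorgan₂ (f x) (any f xs)))

any-not : ∀ {X : Set} (f : X → Bool) xs → any (not ∘ f) xs ≡ not (all f xs)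
any-not f []       = refl
any-not f (x ∷ xs) = trans (cong (not (f x) ∨_) (any-not f xs)) (sym (deMorgan₁ (f x) (all f xs)))

prefixVars : ∀ a k → Vec (Fin (a + k)) a
prefixVars a k = tabulate (_↑ˡ k)

suffixVars : ∀ a k → Vec (Fin (a + k)) k
suffixVars a k = tabulate (a ↑ʳ_)

map-lookup-prefixVars : ∀ {X : Set} {a k} (u : Vec X a) (w : Vec X k) →
                        V.map (lookup (u ++ w)) (prefixVars a k) ≡ u
map-lookup-prefixVars u w =
  trans (sym (tabulate-∘ _ _)) (trans (tabulate-cong (lookup-++ˡ u w)) (tabulate∘lookup u))

map-lookup-suffixVars : ∀ {X : Set} {a k} (u : Vec X a) (w : Vec X k) →
                        V.map (lookup (u ++ w)) (suffixVars a k) ≡ w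
map-lookup-suffixVars u w =
  trans (sym (tabulate-∘ _ _)) (trans (tabulate-cong (lookup-++ʳ u w)) (tabulate∘lookup w))

map-subst : ∀ {X Y : Set} (f : X → Y) {k k'} (e : k ≡ k') (xs : Vec X k) →
            V.map f (subst (Vec X) e xs) ≡ subst (Vec Y) e (V.map f xs)
map-subst f refl xs = refl

eval-eq : ∀ {Σs m n} (i j : Fin m) (𝒮 : Structure Σs n) ρ →
          eval (eq i j) 𝒮 ρ ≡ does (lookup ρ i Fin.≟ lookup ρ j)
eval-eq i j 𝒮 ρ with lookup ρ i Fin.≟ lookup ρ j
... | yes _ = refl
... | no _  = refl

atom⇒negFree : ∀ {Σs m} {φ : Formula Σs m} → IsAtom φ → NegFree φ
atom⇒negFree (rel s ts) = rel s ts
atom⇒negFree (eq i j)   = eq i j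

atom⇒qf : ∀ {Σs m} {φ : Formula Σs m} → IsAtom φ → QF φ
atom⇒qf (rel s ts) = rel s ts
atom⇒qf (eq i j)   = eq i j

module _ {Σs : Sig} where

  tupleEq : ∀ {m k} → Vec (Fin m) k → Vec (Fin m) k → Formula Σs m
  tupleEq []       []       = ⊤ᶠ
  tupleEq (i ∷ is) (j ∷ js) = eq i j ∧ᶠ tupleEq is js

  tupleEq-negFree : ∀ {m k} (is js : Vec (Fin m) k) → NegFree (tupleEq is js)
  tupleEq-negFree []       []       = ⊤ᶠ
  tupleEq-negFree (i ∷ is) (j ∷ js) = eq i j ∧ᶠ tupleEq-negFree is js

  tupleEq-qf : ∀ {m k} (is js : Vec (Fin m) k) → QF (tupleEq is js)
  tupleEq-qf []       []       = ⊤ᶠ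
  tupleEq-qf (i ∷ is) (j ∷ js) = eq i j ∧ᶠ tupleEq-qf is js

  tupleEq-sound : ∀ {m n k} (is js : Vec (Fin m) k) (𝒮 : Structure Σs n) ρ →
                  eval (tupleEq is js) 𝒮 ρ ≡ does (≡-dec Fin._≟_ (V.map (lookup ρ) is) (V.map (lookup ρ) js))
  tupleEq-sound []       []       𝒮 ρ = refl
  tupleEq-sound (i ∷ is) (j ∷ js) 𝒮 ρ = cong₂ _∧_ (eval-eq i j 𝒮 ρ) (tupleEq-sound is js 𝒮 ρ)

  module _ (neqAt : ∀ {m} → Fin m → Fin m → Formula Σs m) where

    tupleNeq : ∀ {m k} → Vec (Fin m) k → Vec (Fin m) k → Formula Σs m
    tupleNeq []       []       = ⊥ᶠ
    tupleNeq (i ∷ is) (j ∷ js) = neqAt i j ∨ᶠ tupleNeq is js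

    module _ (neqAt-atom : ∀ {m} (i j : Fin m) → IsAtom (neqAt i j)) where

      tupleNeq-negFree : ∀ {m k} (is js : Vec (Fin m) k) → NegFree (tupleNeq is js)
      tupleNeq-negFree []       []       = ⊥ᶠ
      tupleNeq-negFree (i ∷ is) (j ∷ js) = atom⇒negFree (neqAt-atom i j) ∨ᶠ tupleNeq-negFree is js

      tupleNeq-qf : ∀ {m k} (is js : Vec (Fin m) k) → QF (tupleNeq is js)
      tupleNeq-qf []       []       = ⊥ᶠ
      tupleNeq-qf (i ∷ is) (j ∷ js) = atom⇒qf (neqAt-atom i j) ∨ᶠ tupleNeq-qf is js

    tupleNeq-sound : ∀ {n} (𝒮 : Structure Σs n) →
      (∀ {m} (i j : Fin m) ρ → eval (neqAt i j) 𝒮 ρ ≡ not (does (lookup ρ i Fin.≟ lookup ρ j))) →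
      ∀ {m k} (is js : Vec (Fin m) k) ρ →
      eval (tupleNeq is js) 𝒮 ρ ≡ not (does (≡-dec Fin._≟_ (V.map (lookup ρ) is) (V.map (lookup ρ) js)))
    tupleNeq-sound 𝒮 neqAt-sound []       []       ρ = refl
    tupleNeq-sound 𝒮 neqAt-sound (i ∷ is) (j ∷ js) ρ =
      trans (cong₂ _∨_ (neqAt-sound i j ρ) (tupleNeq-sound 𝒮 neqAt-sound is js ρ))
            (sym (deMorgan₁ (does (lookup ρ i Fin.≟ lookup ρ j)) _))

-- lit b s ts stands for s(ts) if b is true and for ¬s(ts) otherwise;
-- neqAt i j stands for ¬(i = j).
module NegationNormalForm {Σs Σt : Sig}
  (lit   : Bool → ∀ {m} (s : Symb Σs) → Vec (Fin m) (ar Σs s) → Formula Σt m)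
  (neqAt : ∀ {m} → Fin m → Fin m → Formula Σt m) where

  nnf : ∀ {m} → Formula Σs m → Bool → Formula Σt m
  nnf ⊤ᶠ         true  = ⊤ᶠ
  nnf ⊤ᶠ         false = ⊥ᶠ
  nnf ⊥ᶠ         true  = ⊥ᶠ
  nnf ⊥ᶠ         false = ⊤ᶠ
  nnf (rel s ts) b     = lit b s ts
  nnf (eq i j)   true  = eq i j
  nnf (eq i j)   false = neqAt i j
  nnf (¬ᶠ φ)     b     = nnf φ (not b)
  nnf (φ ∧ᶠ ψ)   true  = nnf φ true ∧ᶠ nnf ψ true
  nnf (φ ∧ᶠ ψ)   false = nnf φ false ∨ᶠ nnf ψ false
  nnf (φ ∨ᶠ ψ)   true  = nnf φ true ∨ᶠ nnf ψ true
  nnf (φ ∨ᶠ ψ)   false = nnf φ false ∧ᶠ nnf ψ false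
  nnf (∃ᶠ φ)     true  = ∃ᶠ (nnf φ true)
  nnf (∃ᶠ φ)     false = ∀ᶠ (nnf φ false)
  nnf (∀ᶠ φ)     true  = ∀ᶠ (nnf φ true)
  nnf (∀ᶠ φ)     false = ∃ᶠ (nnf φ false)

  module _ (lit-atom   : ∀ b {m} s (ts : Vec (Fin m) (ar Σs s)) → IsAtom (lit b s ts))
           (neqAt-atom : ∀ {m} (i j : Fin m) → IsAtom (neqAt i j)) where

    nnf-negFree : ∀ {m} (φ : Formula Σs m) b → NegFree (nnf φ b)
    nnf-negFree ⊤ᶠ         true  = ⊤ᶠ
    nnf-negFree ⊤ᶠ         false = ⊥ᶠ
    nnf-negFree ⊥ᶠ         true  = ⊥ᶠ
    nnf-negFree ⊥ᶠ         false = ⊤ᶠ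
    nnf-negFree (rel s ts) b     = atom⇒negFree (lit-atom b s ts)
    nnf-negFree (eq i j)   true  = eq i j
    nnf-negFree (eq i j)   false = atom⇒negFree (neqAt-atom i j)
    nnf-negFree (¬ᶠ φ)     b     = nnf-negFree φ (not b)
    nnf-negFree (φ ∧ᶠ ψ)   true  = nnf-negFree φ true ∧ᶠ nnf-negFree ψ true
    nnf-negFree (φ ∧ᶠ ψ)   false = nnf-negFree φ false ∨ᶠ nnf-negFree ψ false
    nnf-negFree (φ ∨ᶠ ψ)   true  = nnf-negFree φ true ∨ᶠ nnf-negFree ψ true
    nnf-negFree (φ ∨ᶠ ψ)   false = nnf-negFree φ false ∧ᶠ nnf-negFree ψ false
    nnf-negFree (∃ᶠ φ)     true  = ∃ᶠ (nnf-negFree φ true)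
    nnf-negFree (∃ᶠ φ)     false = ∀ᶠ (nnf-negFree φ false)
    nnf-negFree (∀ᶠ φ)     true  = ∀ᶠ (nnf-negFree φ true)
    nnf-negFree (∀ᶠ φ)     false = ∃ᶠ (nnf-negFree φ false)

    nnf-qf : ∀ {m} {φ : Formula Σs m} → QF φ → ∀ b → QF (nnf φ b)
    nnf-qf ⊤ᶠ         true  = ⊤ᶠ
    nnf-qf ⊤ᶠ         false = ⊥ᶠ
    nnf-qf ⊥ᶠ         true  = ⊥ᶠ
    nnf-qf ⊥ᶠ         false = ⊤ᶠ
    nnf-qf (rel s ts) b     = atom⇒qf (lit-atom b s ts)
    nnf-qf (eq i j)   true  = eq i j
    nnf-qf (eq i j)   false = atom⇒qf (neqAt-atom i j)
    nnf-qf (¬ᶠ q)     b     = nnf-qf q (not b)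
    nnf-qf (q ∧ᶠ r)   true  = nnf-qf q true ∧ᶠ nnf-qf r true
    nnf-qf (q ∧ᶠ r)   false = nnf-qf q false ∨ᶠ nnf-qf r false
    nnf-qf (q ∨ᶠ r)   true  = nnf-qf q true ∨ᶠ nnf-qf r true
    nnf-qf (q ∨ᶠ r)   false = nnf-qf q false ∧ᶠ nnf-qf r false

  module _ {n} (𝒮 : Structure Σs n) (𝒯 : Structure Σt n)
    (lit-sound   : ∀ b {m} s (ts : Vec (Fin m) (ar Σs s)) ρ →
                   eval (lit b s ts) 𝒯 ρ ≡ polar b (𝒮 s (V.map (lookup ρ) ts)))
    (neqAt-sound : ∀ {m} (i j : Fin m) ρ → eval (neqAt i j) 𝒯 ρ ≡ not (does (lookup ρ i Fin.≟ lookup ρ j)))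
    where

    nnf-sound : ∀ {m} (φ : Formula Σs m) b ρ → eval (nnf φ b) 𝒯 ρ ≡ polar b (eval φ 𝒮 ρ)
    nnf-sound ⊤ᶠ         true  ρ = refl
    nnf-sound ⊤ᶠ         false ρ = refl
    nnf-sound ⊥ᶠ         true  ρ = refl
    nnf-sound ⊥ᶠ         false ρ = refl
    nnf-sound (rel s ts) b     ρ = lit-sound b s ts ρ
    nnf-sound (eq i j)   true  ρ = trans (eval-eq i j 𝒯 ρ) (sym (eval-eq i j 𝒮 ρ))
    nnf-sound (eq i j)   false ρ = trans (neqAt-sound i j ρ) (cong not (sym (eval-eq i j 𝒮 ρ)))
    nnf-sound (¬ᶠ φ)     true  ρ = nnf-sound φ false ρ
    nnf-sound (¬ᶠ φ)     false ρ = trans (nnf-sound φ true ρ) (sym (not-involutive _))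
    nnf-sound (φ ∧ᶠ ψ)   true  ρ = cong₂ _∧_ (nnf-sound φ true ρ) (nnf-sound ψ true ρ)
    nnf-sound (φ ∧ᶠ ψ)   false ρ =
      trans (cong₂ _∨_ (nnf-sound φ false ρ) (nnf-sound ψ false ρ)) (sym (deMorgan₁ (eval φ 𝒮 ρ) _))
    nnf-sound (φ ∨ᶠ ψ)   true  ρ = cong₂ _∨_ (nnf-sound φ true ρ) (nnf-sound ψ true ρ)
    nnf-sound (φ ∨ᶠ ψ)   false ρ =
      trans (cong₂ _∧_ (nnf-sound φ false ρ) (nnf-sound ψ false ρ)) (sym (deMorgan₂ (eval φ 𝒮 ρ) _))
    nnf-sound (∃ᶠ φ)     true  ρ = any-cong (λ a → nnf-sound φ true (a ∷ ρ)) (L.allFin n)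
    nnf-sound (∃ᶠ φ)     false ρ =
      trans (all-cong (λ a → nnf-sound φ false (a ∷ ρ)) (L.allFin n)) (all-not (λ a → eval φ 𝒮 (a ∷ ρ)) (L.allFin n))
    nnf-sound (∀ᶠ φ)     true  ρ = all-cong (λ a → nnf-sound φ true (a ∷ ρ)) (L.allFin n)
    nnf-sound (∀ᶠ φ)     false ρ =
      trans (any-cong (λ a → nnf-sound φ false (a ∷ ρ)) (L.allFin n)) (any-not (λ a → eval φ 𝒮 (a ∷ ρ)) (L.allFin n))

module DisjunctiveNormalForm {Σs : Sig} where

  data Atom (m : ℕ) : Set where
    relᵃ : (s : Symb Σs) → Vec (Fin m) (ar Σs s) → Atom m
    eqᵃ  : Fin m → Fin m → Atom m

  Clause : ℕ → Set
  Clause m = List (Atom m)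

  atomFormula : ∀ {m} → Atom m → Formula Σs m
  atomFormula (relᵃ s ts) = rel s ts
  atomFormula (eqᵃ i j)   = eq i j

  conjunction : ∀ {m} → Clause m → Formula Σs m
  conjunction []      = ⊤ᶠ
  conjunction (a ∷ c) = atomFormula a ∧ᶠ conjunction c

  disjunction : ∀ {m} → List (Clause m) → Formula Σs m
  disjunction []      = ⊥ᶠ
  disjunction (c ∷ d) = conjunction c ∨ᶠ disjunction d

  distribute : ∀ {m} → List (Clause m) → List (Clause m) → List (Clause m)
  distribute []       d = []
  distribute (c ∷ d₁) d = L.map (c L.++_) d L.++ distribute d₁ d

  clauses : ∀ {m} {φ : Formula Σs m} → QF φ → NegFree φ → List (Clause m)
  clauses ⊤ᶠ         _          = [] ∷ []
  clauses ⊥ᶠ         _          = []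
  clauses (rel s ts) _          = (relᵃ s ts ∷ []) ∷ []
  clauses (eq i j)   _          = (eqᵃ i j ∷ []) ∷ []
  clauses (¬ᶠ q)     ()
  clauses (q ∧ᶠ r)   (p ∧ᶠ p′) = distribute (clauses q p) (clauses r p′)
  clauses (q ∨ᶠ r)   (p ∨ᶠ p′) = clauses q p L.++ clauses r p′

  dnf : ∀ {m} {φ : Formula Σs m} → QF φ → NegFree φ → Formula Σs m
  dnf q p = disjunction (clauses q p)

  atomFormula-isAtom : ∀ {m} (a : Atom m) → IsAtom (atomFormula a)
  atomFormula-isAtom (relᵃ s ts) = rel s ts
  atomFormula-isAtom (eqᵃ i j)   = eq i j

  conjunction-isConj : ∀ {m} (c : Clause m) → IsConj (conjunction c)
  conjunction-isConj []      = ⊤ᶠ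
  conjunction-isConj (a ∷ c) = atom (atomFormula-isAtom a) ∧ᶠ conjunction-isConj c

  disjunction-isUCQ : ∀ {m} (d : List (Clause m)) → IsUCQ (disjunction d)
  disjunction-isUCQ []      = ⊥ᶠ
  disjunction-isUCQ (c ∷ d) = conj (conjunction-isConj c) ∨ᶠ disjunction-isUCQ d

  dnf-isUCQ : ∀ {m} {φ : Formula Σs m} (q : QF φ) (p : NegFree φ) → IsUCQ (dnf q p)
  dnf-isUCQ q p = disjunction-isUCQ (clauses q p)

  module _ {n m} (𝒮 : Structure Σs n) (ρ : Vec (Fin n) m) where

    ⟦_⟧ : Formula Σs m → Bool
    ⟦ φ ⟧ = eval φ 𝒮 ρ

    conjunction-++ : ∀ c c′ → ⟦ conjunction (c L.++ c′) ⟧ ≡ ⟦ conjunction c ⟧ ∧ ⟦ conjunction c′ ⟧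
    conjunction-++ []      c′ = refl
    conjunction-++ (a ∷ c) c′ =
      trans (cong (⟦ atomFormula a ⟧ ∧_) (conjunction-++ c c′)) (sym (∧-assoc ⟦ atomFormula a ⟧ _ _))

    disjunction-++ : ∀ d d′ → ⟦ disjunction (d L.++ d′) ⟧ ≡ ⟦ disjunction d ⟧ ∨ ⟦ disjunction d′ ⟧
    disjunction-++ []      d′ = refl
    disjunction-++ (c ∷ d) d′ =
      trans (cong (⟦ conjunction c ⟧ ∨_) (disjunction-++ d d′)) (sym (∨-assoc ⟦ conjunction c ⟧ _ _))

    disjunction-map-++ : ∀ c d → ⟦ disjunction (L.map (c L.++_) d) ⟧ ≡ ⟦ conjunction c ⟧ ∧ ⟦ disjunction d ⟧
    disjunction-map-++ c []       = sym (∧-zeroʳ _)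
    disjunction-map-++ c (c′ ∷ d) =
      trans (cong₂ _∨_ (conjunction-++ c c′) (disjunction-map-++ c d)) (sym (∧-distribˡ-∨ ⟦ conjunction c ⟧ _ _))

    disjunction-distribute : ∀ d₁ d₂ → ⟦ disjunction (distribute d₁ d₂) ⟧ ≡ ⟦ disjunction d₁ ⟧ ∧ ⟦ disjunction d₂ ⟧
    disjunction-distribute []       d₂ = refl
    disjunction-distribute (c ∷ d₁) d₂ = begin
      ⟦ disjunction (L.map (c L.++_) d₂ L.++ distribute d₁ d₂) ⟧
        ≡⟨ disjunction-++ (L.map (c L.++_) d₂) (distribute d₁ d₂) ⟩
      ⟦ disjunction (L.map (c L.++_) d₂) ⟧ ∨ ⟦ disjunction (distribute d₁ d₂) ⟧
        ≡⟨ cong₂ _∨_ (disjunction-map-++ c d₂) (disjunction-distribute d₁ d₂) ⟩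
      ⟦ conjunction c ⟧ ∧ ⟦ disjunction d₂ ⟧ ∨ ⟦ disjunction d₁ ⟧ ∧ ⟦ disjunction d₂ ⟧
        ≡⟨ sym (∧-distribʳ-∨ ⟦ disjunction d₂ ⟧ ⟦ conjunction c ⟧ ⟦ disjunction d₁ ⟧) ⟩
      (⟦ conjunction c ⟧ ∨ ⟦ disjunction d₁ ⟧) ∧ ⟦ disjunction d₂ ⟧ ∎
      where open ≡-Reasoning

    dnf-sound : ∀ {φ} (q : QF φ) (p : NegFree φ) → ⟦ dnf q p ⟧ ≡ ⟦ φ ⟧
    dnf-sound ⊤ᶠ         _          = refl
    dnf-sound ⊥ᶠ         _          = refl
    dnf-sound (rel s ts) _          = trans (∨-identityʳ _) (∧-identityʳ _)
    dnf-sound (eq i j)   _          = trans (∨-identityʳ _) (∧-identityʳ _)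
    dnf-sound (¬ᶠ q)     ()
    dnf-sound (q ∧ᶠ r)   (p ∧ᶠ p′) =
      trans (disjunction-distribute (clauses q p) (clauses r p′)) (cong₂ _∧_ (dnf-sound q p) (dnf-sound r p′))
    dnf-sound (q ∨ᶠ r)   (p ∨ᶠ p′) =
      trans (disjunction-++ (clauses q p) (clauses r p′)) (cong₂ _∨_ (dnf-sound q p) (dnf-sound r p′))

injˡ : ∀ σ τ → Sym σ → Sym (σ L.++ τ)
injˡ (_ ∷ σ) τ zero    = zero
injˡ (_ ∷ σ) τ (suc j) = suc (injˡ σ τ j)

injʳ : ∀ σ τ → Sym τ → Sym (σ L.++ τ)
injʳ []      τ j = j
injʳ (_ ∷ σ) τ j = suc (injʳ σ τ j)

arity-injˡ : ∀ σ τ j → arity (σ L.++ τ) (injˡ σ τ j) ≡ arity σ j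
arity-injˡ (_ ∷ σ) τ zero    = refl
arity-injˡ (_ ∷ σ) τ (suc j) = arity-injˡ σ τ j

arity-injʳ : ∀ σ τ j → arity (σ L.++ τ) (injʳ σ τ j) ≡ arity τ j
arity-injʳ []      τ j = refl
arity-injʳ (_ ∷ σ) τ j = arity-injʳ σ τ j

elim-++ : ∀ σ τ (M : Sym (σ L.++ τ) → Set) →
          (∀ j → M (injˡ σ τ j)) → (∀ j → M (injʳ σ τ j)) → ∀ i → M i
elim-++ []      τ M f g i       = g i
elim-++ (_ ∷ σ) τ M f g zero    = f zero
elim-++ (_ ∷ σ) τ M f g (suc i) = elim-++ σ τ (M ∘ suc) (f ∘ suc) g i

elim-++-injˡ : ∀ σ τ M f g j → elim-++ σ τ M f g (injˡ σ τ j) ≡ f j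
elim-++-injˡ (_ ∷ σ) τ M f g zero    = refl
elim-++-injˡ (_ ∷ σ) τ M f g (suc j) = elim-++-injˡ σ τ (M ∘ suc) (f ∘ suc) g j

elim-++-injʳ : ∀ σ τ M f g j → elim-++ σ τ M f g (injʳ σ τ j) ≡ g j
elim-++-injʳ []      τ M f g j = refl
elim-++-injʳ (_ ∷ σ) τ M f g j = elim-++-injʳ σ τ (M ∘ suc) (f ∘ suc) g j

setTuple-self : ∀ σ {n} (D : DB σ n) S a b (w : Tuple n (arity σ S)) →
                setTuple σ D S a b S w ≡ (if does (≡-dec Fin._≟_ w a) then b else D S w)
setTuple-self σ D S a b w with S Fin.≟ S
... | no S≢S = contradiction refl S≢S
... | yes refl with ≡-dec Fin._≟_ w a
...   | yes _ = refl
...   | no _  = refl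

setTuple-other : ∀ σ {n} (D : DB σ n) {S S′} a b (w : Tuple n (arity σ S′)) →
                 ¬ S′ ≡ S → setTuple σ D S a b S′ w ≡ D S′ w
setTuple-other σ D {S} {S′} a b w S′≢S with S′ Fin.≟ S
... | yes S′≡S = contradiction S′≡S S′≢S
... | no _     = refl

not-insert : ∀ c x → not x ∧ not c ≡ not (if c then true else x)
not-insert true  x = ∧-zeroʳ (not x)
not-insert false x = ∧-identityʳ (not x)

not-delete : ∀ c x → not x ∨ c ≡ not (if c then false else x)
not-delete true  x = ∨-zeroʳ (not x)
not-delete false x = ∨-identityʳ (not x)

module _ {τin τaux τaux′} (P : DynProgram τin τaux) (P′ : DynProgram τin τaux′)
  (_≈_ : ∀ {n} → State τin τaux n → DB τaux′ n → Set)
  (step-≈ : ∀ {n} δ (𝒮 : State τin τaux n) A → 𝒮 ≈ A →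
            step (prog P) δ 𝒮 ≈ aux (step (prog P′) δ (state (inp 𝒮) A)))
  where

  run-≈ : ∀ {n} α (𝒮 : State τin τaux n) A → 𝒮 ≈ A →
          run (prog P) α 𝒮 ≈ aux (run (prog P′) α (state (inp 𝒮) A))
  run-≈ []                𝒮 A 𝒮≈A = 𝒮≈A
  run-≈ (mod k S a ∷ α) 𝒮 A 𝒮≈A = run-≈ α _ _ (step-≈ (mod k S a) 𝒮 A 𝒮≈A)

  subst-Query : ∀ {j j′} (e : j ≡ j′) (𝒬 : Query τin j) {n} (D : DB τin n) (b : Tuple n j′) →
                subst (Query τin) e 𝒬 D b ≡ 𝒬 D (subst (Tuple n) (sym e) b)
  subst-Query refl 𝒬 D b = refl

  simulation⇒equivalent :
    (e : qarity P ≡ qarity P′) →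
    (∀ {n} (D : DB τin n) → state D (init P D) ≈ init P′ D) →
    (∀ {n} (𝒮 : State τin τaux n) A → 𝒮 ≈ A → ∀ w → A (Q P′) (subst (Tuple n) e w) ≡ aux 𝒮 (Q P) w) →
    Σ (Query τin (qarity P)) (Maintains P) → Equivalent P P′
  simulation⇒equivalent e init-≈ query-≈ (𝒬 , maintains) = e , 𝒬 , maintains , maintains′
    where
    maintains′ : Maintains P′ (subst (Query τin) e 𝒬)
    maintains′ n D α b = begin
      subst (Query τin) e 𝒬 (applyMods α D) b                        ≡⟨ subst-Query e 𝒬 (applyMods α D) b ⟩
      𝒬 (applyMods α D) w                                            ≡⟨ maintains n D α w ⟩
      aux 𝒮 (Q P) w                                                  ≡⟨ sym (query-≈ 𝒮 A (run-≈ α _ _ (init-≈ D)) w) ⟩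
      A (Q P′) (subst (Tuple n) e w)                                 ≡⟨ cong (A (Q P′)) (subst-subst-sym e) ⟩
      A (Q P′) b                                                     ∎
      where
      open ≡-Reasoning
      w = subst (Tuple n) (sym e) b
      𝒮 = run (prog P) α (state D (init P D))
      A = aux (run (prog P′) α (state D (init P′ D)))

module ComplementConstruction (I A : Schema) (P : UpdateProgram I A) where

  A′ : Schema
  A′ = A L.++ (A L.++ (I L.++ (2 ∷ [])))

  Σ₀ Σ₁ : Sig
  Σ₀ = I ⊕ A
  Σ₁ = I ⊕ A′

  copyˢ coAuxˢ : Sym A → Sym A′
  copyˢ r  = injˡ A _ r
  coAuxˢ r = injʳ A _ (injˡ A _ r)

  coInˢ : Sym I → Sym A′
  coInˢ s = injʳ A _ (injʳ A _ (injˡ I _ s))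

  neqˢ : Sym A′
  neqˢ = injʳ A _ (injʳ A _ (injʳ I _ zero))

  arity-copy : ∀ r → arity A′ (copyˢ r) ≡ arity A r
  arity-copy r = arity-injˡ A _ r

  arity-coAux : ∀ r → arity A′ (coAuxˢ r) ≡ arity A r
  arity-coAux r = trans (arity-injʳ A _ _) (arity-injˡ A _ r)

  arity-coIn : ∀ s → arity A′ (coInˢ s) ≡ arity I s
  arity-coIn s = trans (arity-injʳ A _ _) (trans (arity-injʳ A _ _) (arity-injˡ I _ s))

  arity-neq : arity A′ neqˢ ≡ 2
  arity-neq = trans (arity-injʳ A _ _) (trans (arity-injʳ A _ _) (arity-injʳ I (2 ∷ []) zero))

  data Kind : Sym A′ → Set where
    copy  : ∀ r → Kind (copyˢ r)
    coAux : ∀ r → Kind (coAuxˢ r)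
    coIn  : ∀ s → Kind (coInˢ s)
    neq   : Kind neqˢ

  kind : ∀ R → Kind R
  kind = elim-++ A _ Kind copy
           (elim-++ A _ (Kind ∘ injʳ A _) coAux
             (elim-++ I _ (Kind ∘ injʳ A _ ∘ injʳ A _) coIn λ { zero → neq }))

  kind-copy : ∀ r → kind (copyˢ r) ≡ copy r
  kind-copy r = elim-++-injˡ A _ Kind _ _ r

  kind-coAux : ∀ r → kind (coAuxˢ r) ≡ coAux r
  kind-coAux r = trans (elim-++-injʳ A _ Kind _ _ _) (elim-++-injˡ A _ _ _ _ r)

  kind-coIn : ∀ s → kind (coInˢ s) ≡ coIn s
  kind-coIn s = trans (elim-++-injʳ A _ Kind _ _ _) (trans (elim-++-injʳ A _ _ _ _ _) (elim-++-injˡ I _ _ _ _ s))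

  kind-neq : kind neqˢ ≡ neq
  kind-neq = trans (elim-++-injʳ A _ Kind _ _ _) (trans (elim-++-injʳ A _ _ _ _ _) (elim-++-injʳ I _ _ _ _ zero))

  auxAtom : ∀ {m} (R : Sym A′) {k} → arity A′ R ≡ k → Vec (Fin m) k → Formula Σ₁ m
  auxAtom R e ts = rel (inj₂ R) (subst (Vec (Fin _)) (sym e) ts)

  lit : Bool → ∀ {m} (s : Symb Σ₀) → Vec (Fin m) (ar Σ₀ s) → Formula Σ₁ m
  lit true  (inj₁ s) ts = rel (inj₁ s) ts
  lit false (inj₁ s) ts = auxAtom (coInˢ s) (arity-coIn s) ts
  lit true  (inj₂ r) ts = auxAtom (copyˢ r) (arity-copy r) ts
  lit false (inj₂ r) ts = auxAtom (coAuxˢ r) (arity-coAux r) ts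

  neqAtom : ∀ {m} → Fin m → Fin m → Formula Σ₁ m
  neqAtom i j = auxAtom neqˢ arity-neq (i ∷ j ∷ [])

  lit-atom : ∀ b {m} s (ts : Vec (Fin m) (ar Σ₀ s)) → IsAtom (lit b s ts)
  lit-atom true  (inj₁ s) ts = rel _ _
  lit-atom false (inj₁ s) ts = rel _ _
  lit-atom true  (inj₂ r) ts = rel _ _
  lit-atom false (inj₂ r) ts = rel _ _

  neqAtom-atom : ∀ {m} (i j : Fin m) → IsAtom (neqAtom i j)
  neqAtom-atom i j = rel _ _

  open NegationNormalForm lit neqAtom

  Update : Sym I → ℕ → Set
  Update S k = Formula Σ₁ (arity I S + k)

  modifiedVars : ∀ S k → Vec (Fin (arity I S + k)) (arity I S)
  modifiedVars S k = prefixVars (arity I S) k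

  updatedVars : ∀ S k → Vec (Fin (arity I S + k)) k
  updatedVars S k = suffixVars (arity I S) k

  coInUpdate : ModKind → (S S′ : Sym I) → Dec (S′ ≡ S) → Update S (arity I S′)
  coInUpdate k   S S′ (no _)     = auxAtom (coInˢ S′) (arity-coIn S′) (updatedVars S _)
  coInUpdate ins S S  (yes refl) =
    auxAtom (coInˢ S) (arity-coIn S) (updatedVars S _) ∧ᶠ tupleNeq neqAtom (updatedVars S _) (modifiedVars S _)
  coInUpdate del S S  (yes refl) =
    auxAtom (coInˢ S) (arity-coIn S) (updatedVars S _) ∨ᶠ tupleEq (updatedVars S _) (modifiedVars S _)

  kindUpdate : ModKind → (S : Sym I) → ∀ {R} → Kind R → Update S (arity A′ R)
  kindUpdate k S (copy r)  = subst (Update S) (sym (arity-copy r)) (nnf (P r k S) true)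
  kindUpdate k S (coAux r) = subst (Update S) (sym (arity-coAux r)) (nnf (P r k S) false)
  kindUpdate k S (coIn s)  = subst (Update S) (sym (arity-coIn s)) (coInUpdate k S s (s Fin.≟ S))
  kindUpdate k S neq       = rel (inj₂ neqˢ) (updatedVars S _)

  negFreeProgram : UpdateProgram I A′
  negFreeProgram R k S = kindUpdate k S (kind R)

  coInUpdate-negFree-qf : ∀ k S S′ d → NegFree (coInUpdate k S S′ d) × QF (coInUpdate k S S′ d)
  coInUpdate-negFree-qf k   S S′ (no _)     = rel _ _ , rel _ _
  coInUpdate-negFree-qf ins S S  (yes refl) =
    rel _ _ ∧ᶠ tupleNeq-negFree neqAtom neqAtom-atom _ _ , rel _ _ ∧ᶠ tupleNeq-qf neqAtom neqAtom-atom _ _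
  coInUpdate-negFree-qf del S S  (yes refl) = rel _ _ ∨ᶠ tupleEq-negFree _ _ , rel _ _ ∨ᶠ tupleEq-qf _ _

  subst-negFree : ∀ S {j j′} (e : j ≡ j′) {φ : Update S j} → NegFree φ → NegFree (subst (Update S) e φ)
  subst-negFree S refl p = p

  subst-qf : ∀ S {j j′} (e : j ≡ j′) {φ : Update S j} → QF φ → QF (subst (Update S) e φ)
  subst-qf S refl q = q

  negFreeProgram-negFree : ∀ R k S → NegFree (negFreeProgram R k S)
  negFreeProgram-negFree R k S with kind R
  ... | copy r  = subst-negFree S _ (nnf-negFree lit-atom neqAtom-atom (P r k S) true)
  ... | coAux r = subst-negFree S _ (nnf-negFree lit-atom neqAtom-atom (P r k S) false)
  ... | coIn s  = subst-negFree S _ (proj₁ (coInUpdate-negFree-qf k S s (s Fin.≟ S)))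
  ... | neq     = rel _ _

  negFreeProgram-qf : (∀ R k S → QF (P R k S)) → ∀ R k S → QF (negFreeProgram R k S)
  negFreeProgram-qf qf R k S with kind R
  ... | copy r  = subst-qf S _ (nnf-qf lit-atom neqAtom-atom (qf r k S) true)
  ... | coAux r = subst-qf S _ (nnf-qf lit-atom neqAtom-atom (qf r k S) false)
  ... | coIn s  = subst-qf S _ (proj₂ (coInUpdate-negFree-qf k S s (s Fin.≟ S)))
  ... | neq     = rel _ _

  record Represents {n} (I₀ : DB I n) (A₀ : DB A n) (A₁ : DB A′ n) : Set where
    field
      copy-≡  : ∀ r w → A₁ (copyˢ r)  (subst (Tuple n) (sym (arity-copy r)) w)  ≡ A₀ r w
      coAux-≡ : ∀ r w → A₁ (coAuxˢ r) (subst (Tuple n) (sym (arity-coAux r)) w) ≡ not (A₀ r w)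
      coIn-≡  : ∀ s w → A₁ (coInˢ s)  (subst (Tuple n) (sym (arity-coIn s)) w)  ≡ not (I₀ s w)
      neq-≡   : ∀ x y → A₁ neqˢ (subst (Tuple n) (sym arity-neq) (x ∷ y ∷ [])) ≡ not (does (x Fin.≟ y))

  representationAt : ∀ {n} → DB I n → DB A n → ∀ {R} → Kind R → Rel n (arity A′ R)
  representationAt {n} I₀ A₀ (copy r)  = subst (Rel n) (sym (arity-copy r)) (A₀ r)
  representationAt {n} I₀ A₀ (coAux r) = subst (Rel n) (sym (arity-coAux r)) (not ∘ A₀ r)
  representationAt {n} I₀ A₀ (coIn s)  = subst (Rel n) (sym (arity-coIn s)) (not ∘ I₀ s)
  representationAt {n} I₀ A₀ neq       = subst (Rel n) (sym arity-neq) λ { (x ∷ y ∷ []) → not (does (x Fin.≟ y)) }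

  representation : ∀ {n} → DB I n → DB A n → DB A′ n
  representation I₀ A₀ R = representationAt I₀ A₀ (kind R)

  subst-Rel : ∀ {n j j′} (e : j ≡ j′) (ψ : Rel n j) (w : Tuple n j) → subst (Rel n) e ψ (subst (Tuple n) e w) ≡ ψ w
  subst-Rel refl ψ w = refl

  representation-represents : ∀ {n} (I₀ : DB I n) (A₀ : DB A n) → Represents I₀ A₀ (representation I₀ A₀)
  representation-represents {n} I₀ A₀ = record
    { copy-≡  = λ r w → trans (at (kind-copy r) _) (subst-Rel (sym (arity-copy r)) _ w)
    ; coAux-≡ = λ r w → trans (at (kind-coAux r) _) (subst-Rel (sym (arity-coAux r)) _ w)
    ; coIn-≡  = λ s w → trans (at (kind-coIn s) _) (subst-Rel (sym (arity-coIn s)) _ w)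
    ; neq-≡   = λ x y → trans (at kind-neq _) (subst-Rel (sym arity-neq) _ (x ∷ y ∷ []))
    }
    where
    at : ∀ {R} {κ : Kind R} → kind R ≡ κ → ∀ w → representation I₀ A₀ R w ≡ representationAt I₀ A₀ κ w
    at kind≡κ w = cong (λ κ → representationAt I₀ A₀ κ w) kind≡κ

  module Sound {n} {I₀ : DB I n} {A₀ : DB A n} {A₁ : DB A′ n} (rep : Represents I₀ A₀ A₁) where
    open Represents rep

    𝒮 : Structure Σ₀ n
    𝒮 = asStructure (state {I} {A} I₀ A₀)

    𝒯 : Structure Σ₁ n
    𝒯 = asStructure (state {I} {A′} I₀ A₁)

    auxAtom-sound : ∀ {m} R {k} (e : arity A′ R ≡ k) (ts : Vec (Fin m) k) ρ →
                    eval (auxAtom R e ts) 𝒯 ρ ≡ A₁ R (subst (Tuple n) (sym e) (V.map (lookup ρ) ts))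
    auxAtom-sound R e ts ρ = cong (A₁ R) (map-subst (lookup ρ) (sym e) ts)

    lit-sound : ∀ b {m} s (ts : Vec (Fin m) (ar Σ₀ s)) ρ → eval (lit b s ts) 𝒯 ρ ≡ polar b (𝒮 s (V.map (lookup ρ) ts))
    lit-sound true  (inj₁ s) ts ρ = refl
    lit-sound false (inj₁ s) ts ρ = trans (auxAtom-sound (coInˢ s) (arity-coIn s) ts ρ) (coIn-≡ s _)
    lit-sound true  (inj₂ r) ts ρ = trans (auxAtom-sound (copyˢ r) (arity-copy r) ts ρ) (copy-≡ r _)
    lit-sound false (inj₂ r) ts ρ = trans (auxAtom-sound (coAuxˢ r) (arity-coAux r) ts ρ) (coAux-≡ r _)

    neqAtom-sound : ∀ {m} (i j : Fin m) ρ → eval (neqAtom i j) 𝒯 ρ ≡ not (does (lookup ρ i Fin.≟ lookup ρ j))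
    neqAtom-sound i j ρ = trans (auxAtom-sound neqˢ arity-neq (i ∷ j ∷ []) ρ) (neq-≡ _ _)

    coInAtom-sound : ∀ s {a} (u : Tuple n a) (w : Tuple n (arity I s)) →
                     eval (auxAtom (coInˢ s) (arity-coIn s) (suffixVars a _)) 𝒯 (u ++ w) ≡ not (I₀ s w)
    coInAtom-sound s u w =
      trans (auxAtom-sound (coInˢ s) (arity-coIn s) (suffixVars _ _) (u ++ w))
            (trans (cong (A₁ (coInˢ s) ∘ subst (Tuple n) (sym (arity-coIn s))) (map-lookup-suffixVars u w)) (coIn-≡ s w))

    tupleEq-updated-modified : ∀ S (a : Tuple n (arity I S)) (w : Tuple n (arity I S)) →
      eval (tupleEq (updatedVars S _) (modifiedVars S _)) 𝒯 (a ++ w) ≡ does (≡-dec Fin._≟_ w a)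
    tupleEq-updated-modified S a w =
      trans (tupleEq-sound (updatedVars S _) (modifiedVars S _) 𝒯 (a ++ w))
            (cong₂ (λ x y → does (≡-dec Fin._≟_ x y)) (map-lookup-suffixVars a w) (map-lookup-prefixVars a w))

    tupleNeq-updated-modified : ∀ S (a : Tuple n (arity I S)) (w : Tuple n (arity I S)) →
      eval (tupleNeq neqAtom (updatedVars S _) (modifiedVars S _)) 𝒯 (a ++ w) ≡ not (does (≡-dec Fin._≟_ w a))
    tupleNeq-updated-modified S a w =
      trans (tupleNeq-sound neqAtom 𝒯 neqAtom-sound (updatedVars S _) (modifiedVars S _) (a ++ w))
            (cong₂ (λ x y → not (does (≡-dec Fin._≟_ x y))) (map-lookup-suffixVars a w) (map-lookup-prefixVars a w))

    coInUpdate-sound : ∀ k S (a : Tuple n (arity I S)) S′ (d : Dec (S′ ≡ S)) (w : Tuple n (arity I S′)) →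
                       eval (coInUpdate k S S′ d) 𝒯 (a ++ w) ≡ not (applyMod {I} (mod k S a) I₀ S′ w)
    coInUpdate-sound ins S a S′ (no S′≢S) w =
      trans (coInAtom-sound S′ a w) (cong not (sym (setTuple-other I I₀ a true w S′≢S)))
    coInUpdate-sound del S a S′ (no S′≢S) w =
      trans (coInAtom-sound S′ a w) (cong not (sym (setTuple-other I I₀ a false w S′≢S)))
    coInUpdate-sound ins S a S (yes refl) w = begin
      eval (coInUpdate ins S S (yes refl)) 𝒯 (a ++ w)
        ≡⟨ cong₂ _∧_ (coInAtom-sound S a w) (tupleNeq-updated-modified S a w) ⟩
      not (I₀ S w) ∧ not (does (≡-dec Fin._≟_ w a))
        ≡⟨ not-insert _ (I₀ S w) ⟩
      not (if does (≡-dec Fin._≟_ w a) then true else I₀ S w)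
        ≡⟨ cong not (sym (setTuple-self I I₀ S a true w)) ⟩
      not (setTuple I I₀ S a true S w) ∎
      where open ≡-Reasoning
    coInUpdate-sound del S a S (yes refl) w = begin
      eval (coInUpdate del S S (yes refl)) 𝒯 (a ++ w)
        ≡⟨ cong₂ _∨_ (coInAtom-sound S a w) (tupleEq-updated-modified S a w) ⟩
      not (I₀ S w) ∨ does (≡-dec Fin._≟_ w a)
        ≡⟨ not-delete _ (I₀ S w) ⟩
      not (if does (≡-dec Fin._≟_ w a) then false else I₀ S w)
        ≡⟨ cong not (sym (setTuple-self I I₀ S a false w)) ⟩
      not (setTuple I I₀ S a false S w) ∎
      where open ≡-Reasoning

  eval-subst : ∀ {n} S {j j′} (e : j ≡ j′) (φ : Update S j) (𝒯 : Structure Σ₁ n) (u : Tuple n (arity I S)) (w : Tuple n j) →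
               eval (subst (Update S) e φ) 𝒯 (u ++ subst (Tuple n) e w) ≡ eval φ 𝒯 (u ++ w)
  eval-subst S refl φ 𝒯 u w = refl

  -- Stated for every P′ with the semantics of negFreeProgram, so that it also covers its UCQ normal form.
  module _ (P′ : UpdateProgram I A′)
           (P′≗ : ∀ R k S {n} (𝒯 : Structure Σ₁ n) ρ → eval (P′ R k S) 𝒯 ρ ≡ eval (negFreeProgram R k S) 𝒯 ρ)
    where

    step-represents : ∀ {n} (δ : Mod I n) (𝒮 : State I A n) A₁ → Represents (inp 𝒮) (aux 𝒮) A₁ →
                      let 𝒮′ = step P δ 𝒮 in Represents (inp 𝒮′) (aux 𝒮′) (aux (step P′ δ (state (inp 𝒮) A₁)))
    step-represents {n} (mod k S a) (state I₀ A₀) A₁ rep = record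
      { copy-≡  = λ r w → trans (updated (arity-copy r) (cong (kindUpdate k S) (kind-copy r)) w)
                                (nnf-sound 𝒮 𝒯 lit-sound neqAtom-sound (P r k S) true (a ++ w))
      ; coAux-≡ = λ r w → trans (updated (arity-coAux r) (cong (kindUpdate k S) (kind-coAux r)) w)
                                (nnf-sound 𝒮 𝒯 lit-sound neqAtom-sound (P r k S) false (a ++ w))
      ; coIn-≡  = λ s w → trans (updated (arity-coIn s) (cong (kindUpdate k S) (kind-coIn s)) w)
                                (coInUpdate-sound k S a s (s Fin.≟ S) w)
      ; neq-≡   = λ x y → trans (P′≗ neqˢ k S 𝒯 _)
                         (trans (cong (λ κ → eval (kindUpdate k S κ) 𝒯 (a ++ subst (Tuple n) (sym arity-neq) (x ∷ y ∷ []))) kind-neq)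
                         (trans (cong (A₁ neqˢ) (map-lookup-suffixVars a _)) (neq-≡ x y)))
      }
      where
      open Sound rep
      open Represents rep using (neq-≡)
      updated : ∀ {R j} (e : arity A′ R ≡ j) {φ : Update S j} → kindUpdate k S (kind R) ≡ subst (Update S) (sym e) φ →
                ∀ w → eval (P′ R k S) 𝒯 (a ++ subst (Tuple n) (sym e) w) ≡ eval φ 𝒯 (a ++ w)
      updated {R} e {φ} kindUpdate≡ w =
        trans (P′≗ R k S 𝒯 _) (trans (cong (λ ψ → eval ψ 𝒯 (a ++ subst (Tuple n) (sym e) w)) kindUpdate≡) (eval-subst S (sym e) φ 𝒯 a w))

module _ (I A : Schema) (P : DynProgram I A) where
  open ComplementConstruction I A (prog P)

  withUpdates : UpdateProgram I A′ → DynProgram I A′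
  withUpdates P′ = record { prog = P′ ; init = λ D → representation D (init P D) ; Q = copyˢ (Q P) }

  equivalent-withUpdates : (P′ : UpdateProgram I A′) →
    (∀ R k S {n} (𝒯 : Structure Σ₁ n) ρ → eval (P′ R k S) 𝒯 ρ ≡ eval (negFreeProgram R k S) 𝒯 ρ) →
    Σ (Query I (qarity P)) (Maintains P) → Equivalent P (withUpdates P′)
  equivalent-withUpdates P′ P′≗ =
    simulation⇒equivalent P (withUpdates P′) (λ 𝒮 A₁ → Represents (inp 𝒮) (aux 𝒮) A₁)
      (step-represents P′ P′≗) (sym (arity-copy (Q P)))
      (λ D → representation-represents D (init P D)) (λ 𝒮 A₁ rep → Represents.copy-≡ rep (Q P))

  equivalent-negFree : Σ (Query I (qarity P)) (Maintains P) →
    Σ Schema λ τaux′ → Σ (DynProgram I τaux′) λ P′ → AllUpdates NegFree P′ × Equivalent P P′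
  equivalent-negFree maintained =
    A′ , withUpdates negFreeProgram , negFreeProgram-negFree ,
    equivalent-withUpdates negFreeProgram (λ R k S 𝒯 ρ → refl) maintained

  equivalent-ucq : AllUpdates QF P → Σ (Query I (qarity P)) (Maintains P) →
    Σ Schema λ τaux′ → Σ (DynProgram I τaux′) λ P′ → AllUpdates IsUCQ P′ × Equivalent P P′
  equivalent-ucq qf maintained =
    A′ , withUpdates ucqProgram , (λ R k S → dnf-isUCQ (qf′ R k S) (negFreeProgram-negFree R k S)) ,
    equivalent-withUpdates ucqProgram (λ R k S 𝒯 ρ → dnf-sound 𝒯 ρ (qf′ R k S) (negFreeProgram-negFree R k S)) maintained
    where
    open DisjunctiveNormalForm
    qf′ : ∀ R k S → QF (negFreeProgram R k S)
    qf′ = negFreeProgram-qf qf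
    ucqProgram : UpdateProgram I A′
    ucqProgram R k S = dnf (qf′ R k S) (negFreeProgram-negFree R k S)

lemma3p6 :
  ((τin τaux : Schema) (P : DynProgram τin τaux) →
      Σ (Query τin (qarity P)) (Maintains P) →
      Σ Schema λ τaux' → Σ (DynProgram τin τaux') λ P' →
        AllUpdates NegFree P' × Equivalent P P')
  ×
  ((τin τaux : Schema) (P : DynProgram τin τaux) →
      AllUpdates QF P →
      Σ (Query τin (qarity P)) (Maintains P) →
      Σ Schema λ τaux' → Σ (DynProgram τin τaux') λ P' →
        AllUpdates IsUCQ P' × Equivalent P P')
lemma3p6 = equivalent-negFree , equivalent-ucq
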